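{- Let $\alpha,\beta,\alpha',\beta'$ be $2$-adic integers with $\alpha^2+\beta^2=\alpha'^2+\beta'^2=1$. Suppose that $\alpha,\alpha'$ are odd, $\alpha\equiv\alpha'\pmod 4$ and $\beta\equiv\beta'\pmod 8$. Then in the field $\mathbb{Q}_2(i)=\mathbb{Q}(i)_{(1+i)}$ we have $$\frac{\alpha'+\beta'i}{\alpha+\beta i}=5^{2t}B^4$$ for some $t\in\mathbb{Z}$ and some $B\in\mathbb{Q}_2(i)$ with $B\equiv 1\pmod{2+2i}$. The same conclusion holds if instead $\beta,\beta'$ are odd, $\beta\equiv\beta'\pmod 4$ and $\alpha\equiv\alpha'\pmod 8$.
   Context: $i=\sqrt{ -1}$; $\mathbb{Q}(i)_{(1+i)}$ is the completion of $\mathbb{Q}(i)$ at the prime $(1+i)$ above $2$, and $B\equiv 1\pmod{2+2i}$ means $B-1\in(2+2i)\mathcal O$, where $\mathcal O$ is the ring of integers of $\mathbb{Q}_2(i)$. -}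

module Defs where

open import Data.Nat as ℕ using (ℕ; zero; suc)
open import Data.Integer using (ℤ; +_; -[1+_]; _+_; _-_; _*_)
open import Data.Integer.Divisibility using (_∣_)
open import Data.Product using (Σ; _×_; _,_)
open import Relation.Nullary using (¬_)

-- Level-n approximations of 2-adic numbers: a sequence of integers,
-- the n-th entry being read modulo 2^n.
Seq : Set
Seq = ℕ → ℤ

_≡[2^_]_ : ℤ → ℕ → ℤ → Set
a ≡[2^ n ] b = (+ (2 ℕ.^ n)) ∣ (a - b)

record ℤ₂ : Set where
  constructor mkℤ₂
  field
    seq : Seq
    coh : ∀ n → seq (suc n) ≡[2^ n ] seq n
open ℤ₂ public

const : ℤ → Seq
const c n = c

0s 1s : Seq
0s = const (+ 0)
1s = const (+ 1)

_⊕_ _⊖_ _⊗_ : Seq → Seq → Seq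
(x ⊕ y) n = x n + y n
(x ⊖ y) n = x n - y n
(x ⊗ y) n = x n * y n

_^ˢ_ : Seq → ℕ → Seq
x ^ˢ zero = 1s
x ^ˢ suc k = x ⊗ (x ^ˢ k)

_≈_ : Seq → Seq → Set
x ≈ y = ∀ n → x n ≡[2^ n ] y n

_≡_[mod_] : Seq → Seq → ℤ → Set
a ≡ b [mod m ] = Σ ℤ₂ λ k → (a ⊖ b) ≈ (const m ⊗ seq k)

Odd : ℤ₂ → Set
Odd a = ¬ (seq a ≡ 0s [mod + 2 ])

record GSeq : Set where
  constructor _+i_
  field
    re im : Seq
open GSeq public

𝒪 : Set
𝒪 = ℤ₂ × ℤ₂

toG : 𝒪 → GSeq
toG (a , b) = seq a +i seq b

_⊕ᵍ_ _⊖ᵍ_ _⊗ᵍ_ : GSeq → GSeq → GSeq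
(a +i b) ⊕ᵍ (c +i d) = (a ⊕ c) +i (b ⊕ d)
(a +i b) ⊖ᵍ (c +i d) = (a ⊖ c) +i (b ⊖ d)
(a +i b) ⊗ᵍ (c +i d) = ((a ⊗ c) ⊖ (b ⊗ d)) +i ((a ⊗ d) ⊕ (b ⊗ c))

_^ᵍ_ : GSeq → ℕ → GSeq
x ^ᵍ zero = 1s +i 0s
x ^ᵍ suc k = x ⊗ᵍ (x ^ᵍ k)

_≈ᵍ_ : GSeq → GSeq → Set
x ≈ᵍ y = (re x ≈ re y) × (im x ≈ im y)

_≡1[mod2+2i] : 𝒪 → Set
B ≡1[mod2+2i] = Σ 𝒪 λ c → (toG B ⊖ᵍ (1s +i 0s)) ≈ᵍ ((const (+ 2) +i const (+ 2)) ⊗ᵍ toG c)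

-- 25^t = 5^(2t) for t ∈ ℤ is split as 25^(pos t) / 25^(neg t).
pos neg : ℤ → ℕ
pos (+ n) = n
pos -[1+ n ] = zero
neg (+ n) = zero
neg -[1+ n ] = suc n

25^ : ℕ → GSeq
25^ k = (const (+ 25) ^ˢ k) +i 0s

Case₁ : ℤ₂ → ℤ₂ → ℤ₂ → ℤ₂ → Set
Case₁ α β α' β' = Odd α × Odd α' × (seq α ≡ seq α' [mod + 4 ]) × (seq β ≡ seq β' [mod + 8 ])

{-# OPTIONS --safe #-}
-- Write z = α + βi and z' = α' + β'i; both have norm 1, so z'/z = z' z̄. The congruence
-- hypotheses force z' z̄ ≡ 1 (mod 8), and after multiplying by 25^(-t) for a suitable t ∈ {0, -1}
-- it becomes, modulo 16, the fourth power of some B₀ = 1 + (2+2i)c₀. Since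
-- (B + 4Pu)⁴ ≡ B⁴ + 16Pu (mod 32P) whenever B ≡ 1 (mod 2), a fourth root modulo 2^(n+4) is refined
-- to one modulo 2^(n+5) by changing c only modulo 2^n; the resulting coherent sequence is the
-- 2-adic B with B⁴ = 25^(-t) z'/z.
module Submission where

open import Defs
open import Data.Integer using (ℤ)
open import Data.Product using (Σ; _×_; _,_)
open import Data.Sum using (_⊎_)

open import Data.Nat as ℕ using (ℕ; zero; suc; s≤s)
import Data.Nat.Properties as ℕ
import Data.Integer as Int
open import Data.Integer using (+_; -[1+_]; +0)
import Data.Integer.Properties as Int
open import Data.Integer.DivMod using (_%_; _/_; a≡a%n+[a/n]*n; n%d<d)
open import Data.Integer.Divisibility.Signed
  using (_∣_; divides; ∣-refl; ∣-trans; ∣ᵤ⇒∣; ∣⇒∣ᵤ; ∣m∣n⇒∣m+n; ∣m∣n⇒∣m-n; ∣m⇒∣-m; ∣n⇒∣m*n; ∣m⇒∣m*n;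
         *-monoʳ-∣; *-cancelʳ-∣)
open import Data.Integer.Tactic.RingSolver using () renaming (ring to ℤ-ring)
open import Data.List using (_∷_; [])
open import Data.Maybe using (just; nothing)
open import Data.Product using (proj₁; proj₂)
open import Data.Sum using (inj₁; inj₂)
open import Relation.Nullary using (¬_; contradiction)
open import Relation.Binary.PropositionalEquality
open import Relation.Binary.Bundles using (Setoid)
import Relation.Binary.Reasoning.Setoid as SetoidReasoning
open import Algebra.Bundles using (CommutativeRing)
open import Algebra.Structures {A = ℤ × ℤ} _≡_ using (IsCommutativeRing)
open import Tactic.RingSolver using (solve-∀; solve)
open import Tactic.RingSolver.Core.AlmostCommutativeRing using (AlmostCommutativeRing; fromCommutativeRing)

module _ where
  open import Data.Integer using (_+_; _-_; _*_; -_)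

  2^_ : ℕ → ℤ
  2^ n = + (2 ℕ.^ n)

  2^-+ : ∀ m n → 2^ (m ℕ.+ n) ≡ 2^ m * 2^ n
  2^-+ m n = trans (cong +_ (ℕ.^-distribˡ-+-* 2 m n)) (Int.pos-* (2 ℕ.^ m) (2 ℕ.^ n))

  x-[x-y]≡y : ∀ x y → x - (x - y) ≡ y
  x-[x-y]≡y = solve-∀ ℤ-ring

  x-y+y≡x : ∀ x y → x - y + y ≡ x
  x-y+y≡x = solve-∀ ℤ-ring

  -[x-y]≡y-x : ∀ x y → - (x - y) ≡ y - x
  -[x-y]≡y-x = solve-∀ ℤ-ring

  [x-z]-[y-z]≡x-y : ∀ x y z → (x - z) - (y - z) ≡ x - y
  [x-z]-[y-z]≡x-y = solve-∀ ℤ-ring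

  [x-y]*z≡x*z-y*z : ∀ x y z → (x - y) * z ≡ x * z - y * z
  [x-y]*z≡x*z-y*z = solve-∀ ℤ-ring

  ∣⇒∣+0 : ∀ {m n} → m ∣ n → m ∣ n + +0
  ∣⇒∣+0 {m} {n} = subst (m ∣_) (sym (Int.+-identityʳ n))

  parity : ∀ x → + 2 ∣ x ⊎ + 2 ∣ x - + 1
  parity x with x % + 2 | a≡a%n+[a/n]*n x (+ 2) | n%d<d x (+ 2)
  ... | 0           | x≡ | _ = inj₁ (divides (x / + 2) (trans x≡ (Int.+-identityˡ _)))
  ... | 1           | x≡ | _ = inj₂ (divides (x / + 2) (trans (cong (_- + 1) x≡) (cancel (x / + 2 * + 2))))
    where
    cancel : ∀ y → + 1 + y - + 1 ≡ y
    cancel = solve-∀ ℤ-ring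
  ... | suc (suc _) | _  | s≤s (s≤s ())

  2∣-*-odd : ∀ {k a} → ¬ + 2 ∣ a → + 2 ∣ k * a → + 2 ∣ k
  2∣-*-odd {k} {a} a-odd 2∣ka with parity a
  ... | inj₁ 2∣a   = contradiction 2∣a a-odd
  ... | inj₂ 2∣a-1 = subst (+ 2 ∣_) (identity k a) (∣m∣n⇒∣m-n 2∣ka (∣n⇒∣m*n k 2∣a-1))
    where
    identity : ∀ k a → k * a - k * (a - + 1) ≡ k
    identity = solve-∀ ℤ-ring

  -- Writing a' = a - 4k and b' = b - 8l, comparing the two norms modulo 16 shows that k is even.
  ratio-components-mod-8 : ∀ {a b a' b'} → ¬ + 2 ∣ a → + 4 ∣ a - a' → + 8 ∣ b - b'
    → + 16 ∣ a * a + b * b - + 1 → + 16 ∣ a' * a' + b' * b' - + 1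
    → + 8 ∣ a' * a + b' * b - + 1 × + 8 ∣ b' * a - a' * b
  ratio-components-mod-8 {a} {b} {a'} {b'} a-odd (divides k a-a'≡) (divides l b-b'≡) N =
    subst₂ (λ a' b' → + 16 ∣ a' * a' + b' * b' - + 1 → + 8 ∣ a' * a + b' * b - + 1 × + 8 ∣ b' * a - a' * b)
      {a - k * + 4} {a'} {b - l * + 8} {b'} (x-d≡y a a' a-a'≡) (x-d≡y b b' b-b'≡) shifted
    where
    x-d≡y : ∀ x y {d} → x - y ≡ d → x - d ≡ y
    x-d≡y x y refl = x-[x-y]≡y x y
    norm-difference : ∀ a b k l →
      (a * a + b * b - + 1) - ((a - k * + 4) * (a - k * + 4) + (b - l * + 8) * (b - l * + 8) - + 1)
        + + 16 * (k * k - l * b + + 4 * (l * l)) ≡ k * a * + 8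
    norm-difference = solve-∀ ℤ-ring
    re-identity : ∀ a b k l → (a * a + b * b - + 1) - (+ 4 * (k * a) + + 8 * (l * b))
                            ≡ (a - k * + 4) * a + (b - l * + 8) * b - + 1
    re-identity = solve-∀ ℤ-ring
    im-identity : ∀ a b k l → + 4 * (k * b) - + 8 * (l * a) ≡ (b - l * + 8) * a - (a - k * + 4) * b
    im-identity = solve-∀ ℤ-ring
    shifted : + 16 ∣ (a - k * + 4) * (a - k * + 4) + (b - l * + 8) * (b - l * + 8) - + 1
      → + 8 ∣ (a - k * + 4) * a + (b - l * + 8) * b - + 1 × + 8 ∣ (b - l * + 8) * a - (a - k * + 4) * b
    shifted N' =
        subst (+ 8 ∣_) (re-identity a b k l)
          (∣m∣n⇒∣m-n (∣-trans (divides (+ 2) refl) N) (∣m∣n⇒∣m+n (8∣4k* a) (∣m⇒∣m*n (l * b) ∣-refl)))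
      , subst (+ 8 ∣_) (im-identity a b k l) (∣m∣n⇒∣m-n (8∣4k* b) (∣m⇒∣m*n (l * a) ∣-refl))
      where
      2∣k : + 2 ∣ k
      2∣k = 2∣-*-odd a-odd (*-cancelʳ-∣ (+ 8) (subst (+ 16 ∣_) (norm-difference a b k l)
              (∣m∣n⇒∣m+n (∣m∣n⇒∣m-n N N') (∣m⇒∣m*n _ ∣-refl))))
      8∣4k* : ∀ x → + 8 ∣ + 4 * (k * x)
      8∣4k* x = *-monoʳ-∣ (+ 4) (∣m⇒∣m*n x 2∣k)

module _ where
  open import Data.Integer using (_+_; _-_; _*_; -_)

  *-re-assoc : ∀ a b c d e f → (a * c - b * d) * e - (a * d + b * c) * f
                             ≡ a * (c * e - d * f) - b * (c * f + d * e)
  *-re-assoc = solve-∀ ℤ-ring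

  *-im-assoc : ∀ a b c d e f → (a * c - b * d) * f + (a * d + b * c) * e
                             ≡ a * (c * f + d * e) + b * (c * e - d * f)
  *-im-assoc = solve-∀ ℤ-ring

  *-re-comm : ∀ a b c d → a * c - b * d ≡ c * a - d * b
  *-re-comm = solve-∀ ℤ-ring

  *-im-comm : ∀ a b c d → a * d + b * c ≡ c * b + d * a
  *-im-comm = solve-∀ ℤ-ring

  *-re-identityˡ : ∀ a b → + 1 * a - +0 * b ≡ a
  *-re-identityˡ = solve-∀ ℤ-ring

  *-im-identityˡ : ∀ a b → + 1 * b + +0 * a ≡ b
  *-im-identityˡ = solve-∀ ℤ-ring

  *-re-distribˡ : ∀ a b c d e f → a * (c + e) - b * (d + f) ≡ (a * c - b * d) + (a * e - b * f)
  *-re-distribˡ = solve-∀ ℤ-ring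

  *-im-distribˡ : ∀ a b c d e f → a * (d + f) + b * (c + e) ≡ (a * d + b * c) + (a * f + b * e)
  *-im-distribˡ = solve-∀ ℤ-ring

  *-re-conj : ∀ a b c d → a * c - b * - d ≡ a * c + b * d
  *-re-conj = solve-∀ ℤ-ring

  *-im-conj : ∀ a b c d → a * - d + b * c ≡ b * c - a * d
  *-im-conj = solve-∀ ℤ-ring

ℤ[i] : Set
ℤ[i] = ℤ × ℤ

infixl 6 _+_ _-_
infixl 7 _*_
infix  8 -_

_+_ _*_ : ℤ[i] → ℤ[i] → ℤ[i]
(a , b) + (c , d) = a Int.+ c , b Int.+ d
(a , b) * (c , d) = a Int.* c Int.- b Int.* d , a Int.* d Int.+ b Int.* c

-_ : ℤ[i] → ℤ[i]
- (a , b) = Int.- a , Int.- b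

_-_ : ℤ[i] → ℤ[i] → ℤ[i]
x - y = x + - y

0# 1# i : ℤ[i]
0# = +0 , +0
1# = + 1 , +0
i  = +0 , + 1

ι : ℤ → ℤ[i]
ι a = a , +0

conj : ℤ[i] → ℤ[i]
conj (a , b) = a , Int.- b

*-comm : ∀ x y → x * y ≡ y * x
*-comm (a , b) (c , d) = cong₂ _,_ (*-re-comm a b c d) (*-im-comm a b c d)

*-assoc : ∀ x y z → (x * y) * z ≡ x * (y * z)
*-assoc (a , b) (c , d) (e , f) = cong₂ _,_ (*-re-assoc a b c d e f) (*-im-assoc a b c d e f)

*-identityˡ : ∀ x → 1# * x ≡ x
*-identityˡ (a , b) = cong₂ _,_ (*-re-identityˡ a b) (*-im-identityˡ a b)

*-distribˡ-+ : ∀ x y z → x * (y + z) ≡ x * y + x * z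
*-distribˡ-+ (a , b) (c , d) (e , f) = cong₂ _,_ (*-re-distribˡ a b c d e f) (*-im-distribˡ a b c d e f)

*-conj : ∀ a b c d → (a , b) * conj (c , d) ≡ (a Int.* c Int.+ b Int.* d , b Int.* c Int.- a Int.* d)
*-conj a b c d = cong₂ _,_ (*-re-conj a b c d) (*-im-conj a b c d)

*-ι : ∀ q m → q * ι m ≡ (proj₁ q Int.* m , proj₂ q Int.* m)
*-ι (q₁ , q₂) m = cong₂ _,_
  (trans (cong (λ t → q₁ Int.* m Int.- t) (Int.*-zeroʳ q₂)) (Int.+-identityʳ _))
  (trans (cong (Int._+ q₂ Int.* m) (Int.*-zeroʳ q₁)) (Int.+-identityˡ _))

ι-* : ∀ a b → ι (a Int.* b) ≡ ι a * ι b
ι-* a b = cong₂ _,_ (sym (Int.+-identityʳ _)) (sym (trans (Int.+-identityʳ _) (Int.*-zeroʳ a)))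

ι-2^-+ : ∀ m n → ι (2^ (m ℕ.+ n)) ≡ ι (2^ m) * ι (2^ n)
ι-2^-+ m n = trans (cong ι (2^-+ m n)) (ι-* (2^ m) (2^ n))

+-*-isCommutativeRing : IsCommutativeRing _+_ _*_ -_ 0# 1#
+-*-isCommutativeRing = record
  { isRing = record
    { +-isAbelianGroup = record
      { isGroup = record
        { isMonoid = record
          { isSemigroup = record
            { isMagma = record { isEquivalence = isEquivalence ; ∙-cong = cong₂ _+_ }
            ; assoc   = λ (a , b) (c , d) (e , f) → cong₂ _,_ (Int.+-assoc a c e) (Int.+-assoc b d f)
            }
          ; identity = (λ (a , b) → cong₂ _,_ (Int.+-identityˡ a) (Int.+-identityˡ b))
                     , (λ (a , b) → cong₂ _,_ (Int.+-identityʳ a) (Int.+-identityʳ b))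
          }
        ; inverse = (λ (a , b) → cong₂ _,_ (Int.+-inverseˡ a) (Int.+-inverseˡ b))
                  , (λ (a , b) → cong₂ _,_ (Int.+-inverseʳ a) (Int.+-inverseʳ b))
        ; ⁻¹-cong = cong (-_)
        }
      ; comm = λ (a , b) (c , d) → cong₂ _,_ (Int.+-comm a c) (Int.+-comm b d)
      }
    ; *-cong     = cong₂ _*_
    ; *-assoc    = *-assoc
    ; *-identity = *-identityˡ , λ x → trans (*-comm x 1#) (*-identityˡ x)
    ; distrib    = *-distribˡ-+ , λ x y z → trans (*-comm (y + z) x)
                     (trans (*-distribˡ-+ x y z) (cong₂ _+_ (*-comm x y) (*-comm x z)))
    }
  ; *-comm = *-comm
  }

+-*-commutativeRing : CommutativeRing _ _
+-*-commutativeRing = record { isCommutativeRing = +-*-isCommutativeRing }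

ℤ[i]-ring : AlmostCommutativeRing _ _
ℤ[i]-ring = fromCommutativeRing +-*-commutativeRing λ { (+0 , +0) → just refl ; _ → nothing }

open AlmostCommutativeRing ℤ[i]-ring using (_^_)

infix 4 _≡_⟨mod_⟩

record _≡_⟨mod_⟩ (x y μ : ℤ[i]) : Set where
  constructor congruent
  field
    quotient : ℤ[i]
    equality : x - y ≡ quotient * μ
open _≡_⟨mod_⟩ public using (quotient)

module _ {μ : ℤ[i]} where
  open ≡-Reasoning

  ≡-mod-reflexive : ∀ {x y} → x ≡ y → x ≡ y ⟨mod μ ⟩
  ≡-mod-reflexive {x} refl = congruent 0# (begin
    x - x   ≡⟨ solve (x ∷ μ ∷ []) ℤ[i]-ring ⟩
    0# * μ  ∎)

  ≡-mod-refl : ∀ {x} → x ≡ x ⟨mod μ ⟩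
  ≡-mod-refl = ≡-mod-reflexive refl

  ≡-mod-sym : ∀ {x y} → x ≡ y ⟨mod μ ⟩ → y ≡ x ⟨mod μ ⟩
  ≡-mod-sym {x} {y} (congruent q x-y≡) = congruent (- q) (begin
    y - x      ≡⟨ solve (x ∷ y ∷ []) ℤ[i]-ring ⟩
    - (x - y)  ≡⟨ cong (-_) x-y≡ ⟩
    - (q * μ)  ≡⟨ solve (q ∷ μ ∷ []) ℤ[i]-ring ⟩
    - q * μ    ∎)

  ≡-mod-trans : ∀ {x y z} → x ≡ y ⟨mod μ ⟩ → y ≡ z ⟨mod μ ⟩ → x ≡ z ⟨mod μ ⟩
  ≡-mod-trans {x} {y} {z} (congruent q x-y≡) (congruent r y-z≡) = congruent (q + r) (begin
    x - z              ≡⟨ solve (x ∷ y ∷ z ∷ []) ℤ[i]-ring ⟩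
    (x - y) + (y - z)  ≡⟨ cong₂ _+_ x-y≡ y-z≡ ⟩
    q * μ + r * μ      ≡⟨ solve (q ∷ r ∷ μ ∷ []) ℤ[i]-ring ⟩
    (q + r) * μ        ∎)

  +-cong-mod : ∀ {x y u v} → x ≡ y ⟨mod μ ⟩ → u ≡ v ⟨mod μ ⟩ → x + u ≡ y + v ⟨mod μ ⟩
  +-cong-mod {x} {y} {u} {v} (congruent q x-y≡) (congruent r u-v≡) = congruent (q + r) (begin
    (x + u) - (y + v)  ≡⟨ solve (x ∷ y ∷ u ∷ v ∷ []) ℤ[i]-ring ⟩
    (x - y) + (u - v)  ≡⟨ cong₂ _+_ x-y≡ u-v≡ ⟩
    q * μ + r * μ      ≡⟨ solve (q ∷ r ∷ μ ∷ []) ℤ[i]-ring ⟩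
    (q + r) * μ        ∎)

  *-cong-mod : ∀ {x y u v} → x ≡ y ⟨mod μ ⟩ → u ≡ v ⟨mod μ ⟩ → x * u ≡ y * v ⟨mod μ ⟩
  *-cong-mod {x} {y} {u} {v} (congruent q x-y≡) (congruent r u-v≡) = congruent (q * u + y * r) (begin
    x * u - y * v              ≡⟨ solve (x ∷ y ∷ u ∷ v ∷ []) ℤ[i]-ring ⟩
    (x - y) * u + y * (u - v)  ≡⟨ cong₂ (λ s t → s * u + y * t) x-y≡ u-v≡ ⟩
    q * μ * u + y * (r * μ)    ≡⟨ solve (q ∷ r ∷ u ∷ y ∷ μ ∷ []) ℤ[i]-ring ⟩
    (q * u + y * r) * μ        ∎)

  *-congˡ-mod : ∀ s {x y} → x ≡ y ⟨mod μ ⟩ → s * x ≡ s * y ⟨mod μ ⟩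
  *-congˡ-mod s = *-cong-mod (≡-mod-refl {s})

  ≡-mod-weaken : ∀ ν {x y} → x ≡ y ⟨mod ν * μ ⟩ → x ≡ y ⟨mod μ ⟩
  ≡-mod-weaken ν (congruent q x-y≡) = congruent (q * ν) (trans x-y≡ (sym (*-assoc q ν μ)))

  ≡-mod-*-scale : ∀ c {x y} → x ≡ y ⟨mod μ ⟩ → x * c ≡ y * c ⟨mod μ * c ⟩
  ≡-mod-*-scale c {x} {y} (congruent q x-y≡) = congruent q (begin
    x * c - y * c  ≡⟨ solve (x ∷ y ∷ c ∷ []) ℤ[i]-ring ⟩
    (x - y) * c    ≡⟨ cong (_* c) x-y≡ ⟩
    q * μ * c      ≡⟨ *-assoc q μ c ⟩
    q * (μ * c)    ∎)

  x≡y+quotient*μ : ∀ {x y} (x≡y : x ≡ y ⟨mod μ ⟩) → x ≡ y + quotient x≡y * μ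
  x≡y+quotient*μ {x} {y} (congruent q x-y≡) = begin
    x            ≡⟨ solve (x ∷ y ∷ []) ℤ[i]-ring ⟩
    y + (x - y)  ≡⟨ cong (λ d → y + d) x-y≡ ⟩
    y + q * μ    ∎

≡-mod-resp : ∀ {μ ν x y} → μ ≡ ν → x ≡ y ⟨mod μ ⟩ → x ≡ y ⟨mod ν ⟩
≡-mod-resp refl x≡y = x≡y

mod-setoid : ℤ[i] → Setoid _ _
mod-setoid μ = record
  { Carrier       = ℤ[i]
  ; _≈_           = _≡_⟨mod μ ⟩
  ; isEquivalence = record { refl = ≡-mod-refl ; sym = ≡-mod-sym ; trans = ≡-mod-trans }
  }

module ≡-mod-Reasoning (μ : ℤ[i]) = SetoidReasoning (mod-setoid μ)

≡-mod-ι⇒∣ : ∀ {m x y} → x ≡ y ⟨mod ι m ⟩ → m ∣ proj₁ (x - y) × m ∣ proj₂ (x - y)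
≡-mod-ι⇒∣ {m} (congruent q x-y≡) =
  divides (proj₁ q) (cong proj₁ (trans x-y≡ (*-ι q m))) , divides (proj₂ q) (cong proj₂ (trans x-y≡ (*-ι q m)))

∣⇒≡-mod-ι : ∀ {m x y} → m ∣ proj₁ (x - y) → m ∣ proj₂ (x - y) → x ≡ y ⟨mod ι m ⟩
∣⇒≡-mod-ι {m} (divides q₁ eq₁) (divides q₂ eq₂) =
  congruent (q₁ , q₂) (trans (cong₂ _,_ eq₁ eq₂) (sym (*-ι (q₁ , q₂) m)))

≡-mod-cancel-unit : ∀ {μ z z̄ z' b s} → z * z̄ ≡ 1# ⟨mod μ ⟩ → b ≡ s * (z' * z̄) ⟨mod μ ⟩
  → z' * s ≡ z * b ⟨mod μ ⟩
≡-mod-cancel-unit {μ} {z} {z̄} {z'} {b} {s} zz̄≡1 b≡sz'z̄ = begin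
  z' * s              ≡⟨ solve (z' ∷ s ∷ []) ℤ[i]-ring ⟩
  s * z' * 1#         ≈⟨ *-congˡ-mod (s * z') (≡-mod-sym zz̄≡1) ⟩
  s * z' * (z * z̄)    ≡⟨ solve (s ∷ z' ∷ z ∷ z̄ ∷ []) ℤ[i]-ring ⟩
  z * (s * (z' * z̄))  ≈⟨ *-congˡ-mod z (≡-mod-sym b≡sz'z̄) ⟩
  z * b               ∎
  where open ≡-mod-Reasoning μ

-- 2-adic integers as coherent sequences

coh-∣ : (x : ℤ₂) → ∀ n → 2^ n ∣ seq x (suc n) Int.- seq x n
coh-∣ x n = ∣ᵤ⇒∣ {2^ n} {seq x (suc n) Int.- seq x n} (coh x n)

negate : ℤ₂ → ℤ₂
negate x = mkℤ₂ (λ n → Int.- seq x n)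
  (λ n → ∣⇒∣ᵤ (subst (2^ n ∣_) (Int.neg-distrib-+ (seq x (suc n)) (Int.- seq x n)) (∣m⇒∣-m (coh-∣ x n))))

Coherent : (ℕ → ℤ[i]) → Set
Coherent z = ∀ n → z (suc n) ≡ z n ⟨mod ι (2^ n) ⟩

coherent-+ : ∀ {z} → Coherent z → ∀ k n → z (k ℕ.+ n) ≡ z n ⟨mod ι (2^ n) ⟩
coherent-+ z-coh zero    n = ≡-mod-refl
coherent-+ z-coh (suc k) n = ≡-mod-trans
  (≡-mod-weaken (ι (2^ k)) (≡-mod-resp (ι-2^-+ k n) (z-coh (k ℕ.+ n))))
  (coherent-+ z-coh k n)

pair : ℤ₂ → ℤ₂ → ℕ → ℤ[i]
pair α β n = seq α n , seq β n

pair-coherent : ∀ α β → Coherent (pair α β)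
pair-coherent α β n = ∣⇒≡-mod-ι (coh-∣ α n) (coh-∣ β n)

conj-pair-coherent : ∀ α β → Coherent (λ n → conj (pair α β n))
conj-pair-coherent α β = pair-coherent α (negate β)

fromCoherent : (z : ℕ → ℤ[i]) → Coherent z → 𝒪
fromCoherent z z-coh =
  mkℤ₂ (λ n → proj₁ (z n)) (λ n → ∣⇒∣ᵤ (proj₁ (≡-mod-ι⇒∣ (z-coh n)))) ,
  mkℤ₂ (λ n → proj₂ (z n)) (λ n → ∣⇒∣ᵤ (proj₂ (≡-mod-ι⇒∣ (z-coh n))))

at : ℕ → GSeq → ℤ[i]
at n x = re x n , im x n

≈ᵍ-intro : ∀ {x y} → (∀ n → at n x ≡ at n y ⟨mod ι (2^ n) ⟩) → x ≈ᵍ y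
≈ᵍ-intro x≡y = (λ n → ∣⇒∣ᵤ (proj₁ (≡-mod-ι⇒∣ (x≡y n)))) , (λ n → ∣⇒∣ᵤ (proj₂ (≡-mod-ι⇒∣ (x≡y n))))

at-25^ : ∀ k n → at n (25^ k) ≡ ι ((+ 25) Int.^ k)
at-25^ zero    n = refl
at-25^ (suc k) n = cong (λ (e , _) → ((+ 25) Int.* e , +0)) (at-25^ k n)

≡[mod]-at : ∀ {m} a b → a ≡ b [mod m ] → ∀ n → m ∣ 2^ n → m ∣ a n Int.- b n
≡[mod]-at {m} a b (k , a-b≈mk) n m∣2ⁿ = subst (m ∣_) (x-y+y≡x (a n Int.- b n) (m Int.* seq k n))
  (∣m∣n⇒∣m+n (∣-trans m∣2ⁿ (∣ᵤ⇒∣ {2^ n} {a n Int.- b n Int.- m Int.* seq k n} (a-b≈mk n)))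
             (∣m⇒∣m*n (seq k n) ∣-refl))

parity-stable : (x : ℤ₂) → ∀ n → + 2 ∣ seq x (suc n) Int.- seq x 1
parity-stable x zero    = divides +0 (Int.+-inverseʳ (seq x 1))
parity-stable x (suc n) = subst (+ 2 ∣_) (Int.+-minus-telescope (seq x (suc (suc n))) (seq x (suc n)) (seq x 1))
  (∣m∣n⇒∣m+n (∣-trans (divides (2^ n) (trans (2^-+ 1 n) (Int.*-comm (+ 2) (2^ n)))) (coh-∣ x (suc n)))
             (parity-stable x n))

-- If some positive level of x is even then all of them are, and halving them gives k with x = 2k.
odd-at : (x : ℤ₂) → Odd x → ∀ n → ¬ + 2 ∣ seq x (suc n)
odd-at x x-odd n 2∣xₙ = x-odd (half , λ j → ∣⇒∣ᵤ (x-2h j))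
  where
  2∣x : ∀ j → + 2 ∣ seq x (suc j)
  2∣x j = subst (+ 2 ∣_) (x-y+y≡x (seq x (suc j)) (seq x (suc n)))
    (∣m∣n⇒∣m+n (subst (+ 2 ∣_) ([x-z]-[y-z]≡x-y (seq x (suc j)) (seq x (suc n)) (seq x 1))
                                (∣m∣n⇒∣m-n (parity-stable x j) (parity-stable x n)))
               2∣xₙ)
  h : ℕ → ℤ
  h j = _∣_.quotient (2∣x j)
  x≡2h : ∀ j → seq x (suc j) ≡ h j Int.* + 2
  x≡2h j = _∣_.equality (2∣x j)
  half : ℤ₂
  half = mkℤ₂ h λ j → ∣⇒∣ᵤ (*-cancelʳ-∣ (+ 2) {2^ j} {h (suc j) Int.- h j}
    (subst₂ _∣_ {2^ (suc j)} {2^ j Int.* + 2}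
                {seq x (suc (suc j)) Int.- seq x (suc j)} {(h (suc j) Int.- h j) Int.* + 2}
                (trans (2^-+ 1 j) (Int.*-comm (+ 2) (2^ j)))
                (trans (cong₂ Int._-_ (x≡2h (suc j)) (x≡2h j)) (sym ([x-y]*z≡x*z-y*z (h (suc j)) (h j) (+ 2))))
                (coh-∣ x (suc j))))
  x-2h : ∀ j → 2^ j ∣ (seq x j Int.- +0) Int.- + 2 Int.* h j
  x-2h j = subst (2^ j ∣_) (identity (seq x j) (h j))
    (∣m⇒∣-m (subst (λ t → 2^ j ∣ t Int.- seq x j) (x≡2h j) (coh-∣ x j)))
    where
    identity : ∀ a h → Int.- (h Int.* + 2 Int.- a) ≡ (a Int.- +0) Int.- + 2 Int.* h
    identity = solve-∀ ℤ-ring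

HasUnitNorm : ℤ₂ → ℤ₂ → Set
HasUnitNorm α β = ((seq α ⊗ seq α) ⊕ (seq β ⊗ seq β)) ≈ 1s

norm-at : ∀ α β → HasUnitNorm α β → ∀ n → 2^ n ∣ seq α n Int.* seq α n Int.+ seq β n Int.* seq β n Int.- + 1
norm-at α β N n = ∣ᵤ⇒∣ {2^ n} {seq α n Int.* seq α n Int.+ seq β n Int.* seq β n Int.- + 1} (N n)

unit-norm : ∀ α β → HasUnitNorm α β → ∀ n → pair α β n * conj (pair α β n) ≡ 1# ⟨mod ι (2^ n) ⟩
unit-norm α β N n = subst (_≡ 1# ⟨mod ι (2^ n) ⟩) (sym z*z̄≡N) (∣⇒≡-mod-ι (norm-at α β N n) (divides +0 refl))
  where
  a b : ℤ
  a = seq α n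
  b = seq β n
  z*z̄≡N : (a , b) * conj (a , b) ≡ ι (a Int.* a Int.+ b Int.* b)
  z*z̄≡N = trans (*-conj a b a b) (cong (a Int.* a Int.+ b Int.* b ,_)
    (trans (cong (λ t → b Int.* a Int.- t) (Int.*-comm a b)) (Int.+-inverseʳ (b Int.* a))))

-- Lifting fourth roots

B : ℤ[i] → ℤ[i]
B c = 1# + ι (+ 2) * ((1# + i) * c)

B-1≡[2+2i]c : ∀ c → B c - 1# ≡ (+ 2 , + 2) * c
B-1≡[2+2i]c = identity
  where
  identity : ∀ c → 1# + ι (+ 2) * ((1# + i) * c) - 1# ≡ (+ 2 , + 2) * c
  identity = solve-∀ ℤ[i]-ring

B-coherent : ∀ {c} → Coherent c → Coherent (λ n → B (c n))
B-coherent c-coh n = +-cong-mod (≡-mod-refl {x = 1#}) (*-congˡ-mod (ι (+ 2)) (*-congˡ-mod (1# + i) (c-coh n)))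

B-shift : ∀ c u P → B (c + P * (1# - i) * u) ≡ B c + ι (+ 4) * P * u
B-shift = identity
  where
  identity : ∀ c u P → 1# + ι (+ 2) * ((1# + i) * (c + P * (1# - i) * u))
                     ≡ 1# + ι (+ 2) * ((1# + i) * c) + ι (+ 4) * P * u
  identity = solve-∀ ℤ[i]-ring

fourth-power-step : ∀ d u P
  → (1# + ι (+ 2) * d + ι (+ 4) * P * u) ^ 4 ≡ (1# + ι (+ 2) * d) ^ 4 + ι (+ 16) * P * u ⟨mod ι (+ 32) * P ⟩
fourth-power-step d u P =
  let b = 1# + ι (+ 2) * d
  in congruent (u * (ι (+ 3) * d + ι (+ 6) * d ^ 2 + ι (+ 4) * d ^ 3) + ι (+ 3) * P * u ^ 2 * b ^ 2
                + ι (+ 8) * P ^ 2 * u ^ 3 * b + ι (+ 8) * P ^ 3 * u ^ 4)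
               (solve (d ∷ u ∷ P ∷ []) ℤ[i]-ring)

lift-step : ∀ P c w → B c ^ 4 ≡ w ⟨mod ι (+ 16) * P ⟩
  → Σ ℤ[i] λ c' → c' ≡ c ⟨mod P ⟩ × B c' ^ 4 ≡ w ⟨mod ι (+ 32) * P ⟩
lift-step P c w c-root@(congruent q _) =
  c + P * (1# - i) * - q ,
  congruent ((1# - i) * - q) (solve (c ∷ q ∷ P ∷ []) ℤ[i]-ring) ,
  (begin
    B (c + P * (1# - i) * - q) ^ 4               ≡⟨ cong (_^ 4) (B-shift c (- q) P) ⟩
    (B c + ι (+ 4) * P * - q) ^ 4                ≈⟨ fourth-power-step ((1# + i) * c) (- q) P ⟩
    B c ^ 4 + ι (+ 16) * P * - q                 ≡⟨ cong (_+ ι (+ 16) * P * - q) (x≡y+quotient*μ c-root) ⟩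
    w + q * (ι (+ 16) * P) + ι (+ 16) * P * - q  ≡⟨ solve (w ∷ q ∷ P ∷ []) ℤ[i]-ring ⟩
    w                                            ∎)
  where open ≡-mod-Reasoning (ι (+ 32) * P)

module _ (W : ℕ → ℤ[i]) (W-coherent : Coherent W) where

  Approximation : ℕ → Set
  Approximation n = Σ ℤ[i] λ c → B c ^ 4 ≡ W (4 ℕ.+ n) ⟨mod ι (2^ (4 ℕ.+ n)) ⟩

  refine : ∀ n (a : Approximation n) → Σ (Approximation (suc n)) λ a' → proj₁ a' ≡ proj₁ a ⟨mod ι (2^ n) ⟩
  refine n (c , c-root) =
    let c' , c'≡c , c'-root = lift-step (ι (2^ n)) c (W (5 ℕ.+ n))
          (≡-mod-resp (ι-2^-+ 4 n) (≡-mod-trans c-root (≡-mod-sym (W-coherent (4 ℕ.+ n)))))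
    in (c' , ≡-mod-resp (sym (ι-2^-+ 5 n)) c'-root) , c'≡c

  approximation : Approximation 0 → ∀ n → Approximation n
  approximation a₀ zero    = a₀
  approximation a₀ (suc n) = proj₁ (refine n (approximation a₀ n))

  fourth-root : Approximation 0 → ℕ → ℤ[i]
  fourth-root a₀ n = proj₁ (approximation a₀ n)

  fourth-root-coherent : ∀ a₀ → Coherent (fourth-root a₀)
  fourth-root-coherent a₀ n = proj₂ (refine n (approximation a₀ n))

  fourth-root-correct : ∀ a₀ n → B (fourth-root a₀ n) ^ 4 ≡ W n ⟨mod ι (2^ n) ⟩
  fourth-root-correct a₀ n =
    ≡-mod-trans (≡-mod-weaken (ι (2^ 4)) (≡-mod-resp (ι-2^-+ 4 n) (proj₂ (approximation a₀ n))))
                (coherent-+ W-coherent 4 n)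

-- The residue modulo 16

gaussian-parity : ∀ q → q ≡ 0# ⟨mod ι (+ 2) ⟩ ⊎ q ≡ 1# ⟨mod ι (+ 2) ⟩
                      ⊎ q ≡ i ⟨mod ι (+ 2) ⟩ ⊎ q ≡ 1# + i ⟨mod ι (+ 2) ⟩
gaussian-parity (a , b) with parity a | parity b
... | inj₁ 2∣a   | inj₁ 2∣b   = inj₁ (∣⇒≡-mod-ι (∣⇒∣+0 2∣a) (∣⇒∣+0 2∣b))
... | inj₂ 2∣a-1 | inj₁ 2∣b   = inj₂ (inj₁ (∣⇒≡-mod-ι 2∣a-1 (∣⇒∣+0 2∣b)))
... | inj₁ 2∣a   | inj₂ 2∣b-1 = inj₂ (inj₂ (inj₁ (∣⇒≡-mod-ι (∣⇒∣+0 2∣a) 2∣b-1)))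
... | inj₂ 2∣a-1 | inj₂ 2∣b-1 = inj₂ (inj₂ (inj₂ (∣⇒≡-mod-ι 2∣a-1 2∣b-1)))

≡1-mod-8⇒mod-16 : ∀ {x ε} (x≡1 : x ≡ 1# ⟨mod ι (+ 8) ⟩)
  → quotient x≡1 ≡ ε ⟨mod ι (+ 2) ⟩ → x ≡ 1# + ε * ι (+ 8) ⟨mod ι (+ 16) ⟩
≡1-mod-8⇒mod-16 {x} {ε} x≡1@(congruent q _) q≡ε = begin
  x                 ≡⟨ x≡y+quotient*μ x≡1 ⟩
  1# + q * ι (+ 8)  ≈⟨ +-cong-mod (≡-mod-refl {x = 1#}) (≡-mod-*-scale (ι (+ 8)) q≡ε) ⟩
  1# + ε * ι (+ 8)  ∎
  where open ≡-mod-Reasoning (ι (+ 16))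

-- Modulo 16 we have 25 ≡ 9 and B 1# ⁴ = (3 + 2i)⁴ = -119 + 120i ≡ 9 + 8i, so each of the classes
-- 1, 9, 1 + 8i, 9 + 8i times 1 or 25 is B 0# ⁴ or B 1# ⁴; the quotients below are the exact differences.
fourth-power-mod-16 : ∀ {x} → x ≡ 1# ⟨mod ι (+ 8) ⟩
  → Σ ℤ λ t → pos t ≡ 0 × Σ ℤ[i] λ c₀ → B c₀ ^ 4 ≡ ι ((+ 25) Int.^ neg t) * x ⟨mod ι (+ 16) ⟩
fourth-power-mod-16 x≡1@(congruent q _) with gaussian-parity q
... | inj₁ q≡0 = + 0 , refl , 0# ,
  ≡-mod-trans (congruent 0# refl) (*-congˡ-mod (ι (+ 1)) (≡-mod-sym (≡1-mod-8⇒mod-16 x≡1 q≡0)))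
... | inj₂ (inj₁ q≡1) = -[1+ 0 ] , refl , 0# ,
  ≡-mod-trans (congruent (-[1+ 13 ] , +0) refl) (*-congˡ-mod (ι (+ 25)) (≡-mod-sym (≡1-mod-8⇒mod-16 x≡1 q≡1)))
... | inj₂ (inj₂ (inj₁ q≡i)) = -[1+ 0 ] , refl , 1# ,
  ≡-mod-trans (congruent (-[1+ 8 ] , -[1+ 4 ]) refl) (*-congˡ-mod (ι (+ 25)) (≡-mod-sym (≡1-mod-8⇒mod-16 x≡1 q≡i)))
... | inj₂ (inj₂ (inj₂ q≡1+i)) = + 0 , refl , 1# ,
  ≡-mod-trans (congruent (-[1+ 7 ] , + 7) refl) (*-congˡ-mod (ι (+ 1)) (≡-mod-sym (≡1-mod-8⇒mod-16 x≡1 q≡1+i)))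

*-conj-≡1-mod-8 : ∀ {a b a' b'} → + 8 ∣ a' Int.* a Int.+ b' Int.* b Int.- + 1 → + 8 ∣ b' Int.* a Int.- a' Int.* b
  → (a' , b') * conj (a , b) ≡ 1# ⟨mod ι (+ 8) ⟩
*-conj-≡1-mod-8 {a} {b} {a'} {b'} re im =
  subst (_≡ 1# ⟨mod ι (+ 8) ⟩) (sym (*-conj a' b' a b)) (∣⇒≡-mod-ι re (∣⇒∣+0 im))

module _ {α β α' β' : ℤ₂} (N : HasUnitNorm α β) (N' : HasUnitNorm α' β') where
  private
    a b a' b' : ℤ
    a  = seq α 4
    b  = seq β 4
    a' = seq α' 4
    b' = seq β' 4

    swap : ∀ x y → + 16 ∣ x Int.* x Int.+ y Int.* y Int.- + 1 → + 16 ∣ y Int.* y Int.+ x Int.* x Int.- + 1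
    swap x y = subst (λ t → + 16 ∣ t Int.- + 1) (Int.+-comm (x Int.* x) (y Int.* y))

  ratio-≡1-mod-8 : Case₁ α β α' β' ⊎ Case₁ β α β' α' → pair α' β' 4 * conj (pair α β 4) ≡ 1# ⟨mod ι (+ 8) ⟩
  ratio-≡1-mod-8 (inj₁ (α-odd , _ , α≡α' , β≡β')) =
    let re , im = ratio-components-mod-8 {a} {b} {a'} {b'} (odd-at α α-odd 3)
                    (≡[mod]-at (seq α) (seq α') α≡α' 4 (divides (+ 4) refl))
                    (≡[mod]-at (seq β) (seq β') β≡β' 4 (divides (+ 2) refl))
                    (norm-at α β N 4) (norm-at α' β' N' 4)
    in *-conj-≡1-mod-8 {a} {b} {a'} {b'} re im
  ratio-≡1-mod-8 (inj₂ (β-odd , _ , β≡β' , α≡α')) =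
    let re , im = ratio-components-mod-8 {b} {a} {b'} {a'} (odd-at β β-odd 3)
                    (≡[mod]-at (seq β) (seq β') β≡β' 4 (divides (+ 4) refl))
                    (≡[mod]-at (seq α) (seq α') α≡α' 4 (divides (+ 2) refl))
                    (swap a b (norm-at α β N 4)) (swap a' b' (norm-at α' β' N' 4))
    in *-conj-≡1-mod-8 {a} {b} {a'} {b'}
         (subst (λ t → + 8 ∣ t Int.- + 1) (Int.+-comm (b' Int.* b) (a' Int.* a)) re)
         (subst (+ 8 ∣_) (-[x-y]≡y-x (a' Int.* b) (b' Int.* a)) (∣m⇒∣-m im))

fourth-power-expansion : ∀ z b → z * b ^ 4 ≡ z * 1# * (b * (b * (b * (b * 1#))))
fourth-power-expansion = solve-∀ ℤ[i]-ring

ratio-is-fourth-power : ∀ α β α' β' → HasUnitNorm α β → (t : ℤ) → pos t ≡ 0 → (c₀ : ℤ[i])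
  → B c₀ ^ 4 ≡ ι ((+ 25) Int.^ neg t) * (pair α' β' 4 * conj (pair α β 4)) ⟨mod ι (+ 16) ⟩
  → Σ 𝒪 λ u → (u ≡1[mod2+2i])
      × (((seq α' +i seq β') ⊗ᵍ 25^ (neg t)) ≈ᵍ (((seq α +i seq β) ⊗ᵍ 25^ (pos t)) ⊗ᵍ (toG u ^ᵍ 4)))
ratio-is-fourth-power α β α' β' N t pos-t≡0 c₀ c₀-root =
  u , (fromCoherent c c-coherent , ≈ᵍ-intro λ n → ≡-mod-reflexive (B-1≡[2+2i]c (c n))) , ≈ᵍ-intro ratio
  where
  z z' W : ℕ → ℤ[i]
  z  = pair α β
  z' = pair α' β'
  W n = ι ((+ 25) Int.^ neg t) * (z' n * conj (z n))

  W-coherent : Coherent W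
  W-coherent n = *-congˡ-mod (ι ((+ 25) Int.^ neg t)) (*-cong-mod (pair-coherent α' β' n) (conj-pair-coherent α β n))

  c : ℕ → ℤ[i]
  c = fourth-root W W-coherent (c₀ , c₀-root)

  c-coherent : Coherent c
  c-coherent = fourth-root-coherent W W-coherent (c₀ , c₀-root)

  u : 𝒪
  u = fromCoherent (λ n → B (c n)) (B-coherent c-coherent)

  ratio : ∀ n → at n ((seq α' +i seq β') ⊗ᵍ 25^ (neg t))
                  ≡ at n (((seq α +i seq β) ⊗ᵍ 25^ (pos t)) ⊗ᵍ (toG u ^ᵍ 4)) ⟨mod ι (2^ n) ⟩
  ratio n = begin
    z' n * at n (25^ (neg t))      ≡⟨ cong (z' n *_) (at-25^ (neg t) n) ⟩
    z' n * ι ((+ 25) Int.^ neg t)  ≈⟨ ≡-mod-cancel-unit {z = z n} {conj (z n)} {z' n}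
                                        (unit-norm α β N n) (fourth-root-correct W W-coherent (c₀ , c₀-root) n) ⟩
    z n * B (c n) ^ 4              ≡⟨ fourth-power-expansion (z n) (B (c n)) ⟩
    z n * 1# * B⁴                  ≡⟨ cong (λ e → z n * e * B⁴) (sym 25^pos-t≡1) ⟩
    z n * at n (25^ (pos t)) * B⁴  ∎
    where
    open ≡-mod-Reasoning (ι (2^ n))
    B⁴ : ℤ[i]
    B⁴ = B (c n) * (B (c n) * (B (c n) * (B (c n) * 1#)))
    25^pos-t≡1 : at n (25^ (pos t)) ≡ 1#
    25^pos-t≡1 = trans (at-25^ (pos t) n) (cong (λ k → ι ((+ 25) Int.^ k)) pos-t≡0)

lemma2p11 : (α β α' β' : ℤ₂)
    → ((seq α ⊗ seq α) ⊕ (seq β ⊗ seq β)) ≈ 1s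
    → ((seq α' ⊗ seq α') ⊕ (seq β' ⊗ seq β')) ≈ 1s
    → Case₁ α β α' β' ⊎ Case₁ β α β' α'
    → Σ ℤ λ t → Σ 𝒪 λ B → (B ≡1[mod2+2i])
        × (((seq α' +i seq β') ⊗ᵍ 25^ (neg t)) ≈ᵍ (((seq α +i seq β) ⊗ᵍ 25^ (pos t)) ⊗ᵍ (toG B ^ᵍ 4)))
lemma2p11 α β α' β' N N' cases =
  let t , pos-t≡0 , c₀ , c₀-root = fourth-power-mod-16 (ratio-≡1-mod-8 {α} {β} {α'} {β'} N N' cases)
  in t , ratio-is-fourth-power α β α' β' N t pos-t≡0 c₀ c₀-root
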